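{- Let $r_1\mid r_2\mid\cdots\mid r_n$ be positive integers, $p$ a prime dividing $r_n$, and $\vec\beta,\vec\beta'$ integer vectors with $0\le\beta_j,\beta'_j\le r_j-1$. If $A_{\vec\beta,p}=A_{\vec\beta',p}$, then $v_p(\gcd(\beta_j,r_j))=v_p(\gcd(\beta'_j,r_j))$ for $j=1,\dots,n$.
   Context: $v_p$ is the $p$-adic valuation, and $\gcd(0,r_j)=r_j$. Let $\mathcal R^\dagger_p=\{1,\dots,p^{v_p(r_1)}\}\times\cdots\times\{1,\dots,p^{v_p(r_n)}\}$ and for an integer vector $\vec\beta$ let $A_{\vec\beta,p}=\{\vec\omega\in\mathcal R^\dagger_p:\sum_{j=1}^np^{v_p(r_n)-v_p(r_j)}\omega_j\beta_j\equiv0\pmod{p^{v_p(r_n)}}\}$. -}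

module Defs where

open import Data.Nat using (ℕ; _+_; _*_; _^_; _∸_; _≤_; _<_; NonZero)
open import Data.Nat.DivMod using (_/_; _%_)
open import Data.Nat.Divisibility using (_∣_; _∣?_)
open import Data.Fin using (Fin; fromℕ; zero; suc)
open import Data.Nat.GCD using (gcd)
open import Data.Product using (_×_)
open import Relation.Nullary using (yes; no; ¬_)
open import Relation.Binary.PropositionalEquality using (_≡_)
open import Function.Bundles using (_⇔_)

-- p-adic valuation v_p(m), via fuel (fuel m suffices for m ≥ 1, p ≥ 2).
-- Convention for degenerate cases (never used in the statement): v_p(0) = 0, p ≤ 1 gives 0.
vpFuel : ℕ → (p : ℕ) → ℕ → ℕ
vpFuel ℕ.zero p m = 0
vpFuel (ℕ.suc f) p ℕ.zero = 0
vpFuel (ℕ.suc f) 0 (ℕ.suc m) = 0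
vpFuel (ℕ.suc f) 1 (ℕ.suc m) = 0
vpFuel (ℕ.suc f) p@(ℕ.suc (ℕ.suc _)) (ℕ.suc m) with p ∣? ℕ.suc m
... | yes _ = ℕ.suc (vpFuel f p (ℕ.suc m / p))
... | no _ = 0

vp : (p : ℕ) → ℕ → ℕ
vp p m = vpFuel m p m

-- gcd(0, r) = r is built into Data.Nat.GCD.gcd.

last : ∀ {n} → Fin (ℕ.suc n)
last {n} = fromℕ n

InR† : ∀ {n} (r : Fin n → ℕ) (p : ℕ) → (Fin n → ℕ) → Set
InR† r p ω = ∀ j → 1 ≤ ω j × ω j ≤ p ^ vp p (r j)

sumFin : ∀ {n} → (Fin n → ℕ) → ℕ
sumFin {ℕ.zero} f = 0
sumFin {ℕ.suc n} f = f zero + sumFin (λ j → f (suc j))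

-- ω ∈ A_{β,p}  (β has nonnegative entries, so the sum is in ℕ; the congruence
-- ≡ 0 (mod p^{v_p(r_n)}) is stated as divisibility.)
InA : ∀ {n} (r : Fin (ℕ.suc n) → ℕ) (p : ℕ) →
      (β : Fin (ℕ.suc n) → ℕ) → (Fin (ℕ.suc n) → ℕ) → Set
InA r p β ω =
  InR† r p ω ×
  (p ^ vp p (r last)) ∣ sumFin (λ j → p ^ (vp p (r last) ∸ vp p (r j)) * ω j * β j)

-- Fix j and write e_k = v_p(r_k). Since r_k ∣ r_n, the vector ω with ω_k = p^{e_k} for k ≠ j
-- and ω_j = p^{e_j - s} lies in A_{β,p} exactly when p^s ∣ β_j: every other summand is already
-- p^{e_n} β_k. So A_{β,p} determines, for each s ≤ e_j, whether p^s divides β_j, i.e. whether it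
-- divides gcd(β_j, r_j), and hence determines v_p(gcd(β_j, r_j)).
module Submission where

open import Data.Fin using (Fin; inject₁; _≟_) renaming (zero to fzero; suc to fsuc)
open import Data.Fin.Properties using () renaming (suc-injective to fsuc-injective)
open import Data.Nat.Base
open import Data.Nat.Divisibility
open import Data.Nat.DivMod using (_/_; m*[n/m]≡n; m/n<m; m≥n⇒m/n>0)
open import Data.Nat.GCD using (gcd; gcd[m,n]∣m; gcd[m,n]∣n; gcd-greatest; gcd[m,n]≢0)
open import Data.Nat.Primality using (Prime; prime⇒nonTrivial)
open import Data.Nat.Properties hiding (_≟_)
open import Data.Product using (_×_; _,_; proj₁; proj₂)
open import Data.Sum using (inj₂)
open import Data.Vec.Functional using (updateAt)
open import Data.Vec.Functional.Properties using (updateAt-updates; updateAt-minimal)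
open import Function using (_∘_)
open import Function.Bundles using (_⇔_; mk⇔; Equivalence)
open import Function.Properties.Equivalence using () renaming (trans to ⇔-trans)
open import Relation.Binary.PropositionalEquality
open import Relation.Nullary using (yes; no; contradiction)

open import Defs

open Equivalence using (to; from)

^∣⇔≤vpFuel : ∀ p .{{_ : NonTrivial p}} f m .{{_ : NonZero m}} → m ≤ f →
             ∀ k → p ^ k ∣ m ⇔ k ≤ vpFuel f p m
^∣⇔≤vpFuel p@(2+ _) (suc f) m@(suc _) m≤f k with p ∣? m
... | no p∤m = mk⇔ (pᵏ∣m⇒k≤0 k) λ { z≤n → 1∣ m }
  where
  pᵏ∣m⇒k≤0 : ∀ k → p ^ k ∣ m → k ≤ 0
  pᵏ∣m⇒k≤0 zero    _     = z≤n
  pᵏ∣m⇒k≤0 (suc k) pᵏ∣m = contradiction (∣-trans (m∣m*n (p ^ k)) pᵏ∣m) p∤m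
... | yes p∣m = mk⇔ (divides⇒≤ k) (≤⇒divides k)
  where
  c : ℕ
  c = m / p
  m≡p*c : m ≡ p * c
  m≡p*c = sym (m*[n/m]≡n p∣m)
  instance _ = >-nonZero (m≥n⇒m/n>0 (∣⇒≤ p∣m))
  IH : ∀ k → p ^ k ∣ c ⇔ k ≤ vpFuel f p c
  IH = ^∣⇔≤vpFuel p f c (≤-trans (≤-pred (m/n<m m p (nonTrivial⇒n>1 p))) (≤-pred m≤f))
  divides⇒≤ : ∀ k → p ^ k ∣ m → k ≤ suc (vpFuel f p c)
  divides⇒≤ zero    _     = z≤n
  divides⇒≤ (suc k) pᵏ∣m = s≤s (to (IH k) (*-cancelˡ-∣ p (subst (p ^ suc k ∣_) m≡p*c pᵏ∣m)))
  ≤⇒divides : ∀ k → k ≤ suc (vpFuel f p c) → p ^ k ∣ m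
  ≤⇒divides zero    _       = 1∣ m
  ≤⇒divides (suc k) (s≤s k≤) = subst (p ^ suc k ∣_) (sym m≡p*c) (*-monoʳ-∣ p (from (IH k) k≤))

gcd-nonZeroʳ : ∀ a r .{{_ : NonZero r}} → NonZero (gcd a r)
gcd-nonZeroʳ a r = ≢-nonZero (gcd[m,n]≢0 a r (inj₂ (≢-nonZero⁻¹ r)))

module _ {p} .{{_ : NonTrivial p}} where

  ^∣⇔≤vp : ∀ m .{{_ : NonZero m}} k → p ^ k ∣ m ⇔ k ≤ vp p m
  ^∣⇔≤vp m = ^∣⇔≤vpFuel p m m ≤-refl

  ^vp∣ : ∀ m .{{_ : NonZero m}} → p ^ vp p m ∣ m
  ^vp∣ m = from (^∣⇔≤vp m (vp p m)) ≤-refl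

  vp-mono-∣ : ∀ {m n} .{{_ : NonZero m}} .{{_ : NonZero n}} → m ∣ n → vp p m ≤ vp p n
  vp-mono-∣ {m} {n} m∣n = to (^∣⇔≤vp n (vp p m)) (∣-trans (^vp∣ m) m∣n)

  vp-gcd-mono : ∀ a a′ r .{{_ : NonZero r}} →
                (∀ s → p ^ s ∣ r → p ^ s ∣ a → p ^ s ∣ a′) →
                vp p (gcd a r) ≤ vp p (gcd a′ r)
  vp-gcd-mono a a′ r transfer =
    to (^∣⇔≤vp (gcd a′ r) d) (gcd-greatest (transfer d pᵈ∣r pᵈ∣a) pᵈ∣r)
    where
    instance _ = gcd-nonZeroʳ a r; _ = gcd-nonZeroʳ a′ r
    d : ℕ
    d = vp p (gcd a r)
    pᵈ∣a : p ^ d ∣ a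
    pᵈ∣a = ∣-trans (^vp∣ (gcd a r)) (gcd[m,n]∣m a r)
    pᵈ∣r : p ^ d ∣ r
    pᵈ∣r = ∣-trans (^vp∣ (gcd a r)) (gcd[m,n]∣n a r)

∣-sumFin : ∀ {n d} (f : Fin n → ℕ) → (∀ k → d ∣ f k) → d ∣ sumFin f
∣-sumFin {zero} {d} f d∣f = d ∣0
∣-sumFin {suc n} f d∣f = ∣m∣n⇒∣m+n (d∣f fzero) (∣-sumFin (f ∘ fsuc) (d∣f ∘ fsuc))

∣sumFin⇔∣ : ∀ {n d} (f : Fin n → ℕ) j → (∀ k → k ≢ j → d ∣ f k) → d ∣ sumFin f ⇔ d ∣ f j
∣sumFin⇔∣ {suc n} {d} f fzero d∣f =
  mk⇔ (λ d∣Σ → ∣m+n∣m⇒∣n (subst (d ∣_) (+-comm (f fzero) _) d∣Σ) d∣rest)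
      (λ d∣f₀ → ∣m∣n⇒∣m+n d∣f₀ d∣rest)
  where
  d∣rest : d ∣ sumFin (f ∘ fsuc)
  d∣rest = ∣-sumFin (f ∘ fsuc) (λ k → d∣f (fsuc k) λ ())
∣sumFin⇔∣ {suc n} {d} f (fsuc j) d∣f =
  mk⇔ (λ d∣Σ → to IH (∣m+n∣m⇒∣n d∣Σ d∣f₀)) (λ d∣fⱼ → ∣m∣n⇒∣m+n d∣f₀ (from IH d∣fⱼ))
  where
  d∣f₀ : d ∣ f fzero
  d∣f₀ = d∣f fzero λ ()
  IH : d ∣ sumFin (f ∘ fsuc) ⇔ d ∣ f (fsuc j)
  IH = ∣sumFin⇔∣ (f ∘ fsuc) j (λ k k≢j → d∣f (fsuc k) (k≢j ∘ fsuc-injective))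

∣-last : ∀ n (r : Fin (suc n) → ℕ) → (∀ j → r (inject₁ j) ∣ r (fsuc j)) → ∀ j → r j ∣ r last
∣-last zero    r r∣r fzero    = ∣-refl
∣-last (suc n) r r∣r fzero    = ∣-trans (r∣r fzero) (∣-last n (r ∘ fsuc) (r∣r ∘ fsuc) fzero)
∣-last (suc n) r r∣r (fsuc j) = ∣-last n (r ∘ fsuc) (r∣r ∘ fsuc) j

m^[n∸k]*m^k≡m^n : ∀ m {n k} → k ≤ n → m ^ (n ∸ k) * m ^ k ≡ m ^ n
m^[n∸k]*m^k≡m^n m {n} {k} k≤n =
  trans (sym (^-distribˡ-+-* m (n ∸ k) k)) (cong (m ^_) (m∸n+n≡m k≤n))

m^n∣m^[n∸k]*x⇔m^k∣x : ∀ m .{{_ : NonZero m}} {n k} x → k ≤ n →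
                       m ^ n ∣ m ^ (n ∸ k) * x ⇔ m ^ k ∣ x
m^n∣m^[n∸k]*x⇔m^k∣x m {n} {k} x k≤n = mk⇔
  (λ h → *-cancelˡ-∣ (m ^ (n ∸ k)) {{m^n≢0 m (n ∸ k)}}
           (subst (_∣ m ^ (n ∸ k) * x) (sym split) h))
  (λ h → subst (_∣ m ^ (n ∸ k) * x) split (*-monoʳ-∣ (m ^ (n ∸ k)) h))
  where
  split : m ^ (n ∸ k) * m ^ k ≡ m ^ n
  split = m^[n∸k]*m^k≡m^n m k≤n

module Probe {n} (r : Fin (suc n) → ℕ) (p : ℕ) .{{_ : NonTrivial p}} where

  instance _ = nonTrivial⇒nonZero p

  e : Fin (suc n) → ℕ
  e k = vp p (r k)

  probe : Fin (suc n) → ℕ → Fin (suc n) → ℕ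
  probe j s = updateAt (λ k → p ^ e k) j (λ _ → p ^ (e j ∸ s))

  probe-at : ∀ j s → probe j s j ≡ p ^ (e j ∸ s)
  probe-at j s = updateAt-updates j (λ k → p ^ e k)

  probe-off : ∀ j s k → k ≢ j → probe j s k ≡ p ^ e k
  probe-off j s k = updateAt-minimal k j (λ k → p ^ e k)

  probe∈R† : ∀ j s → InR† r p (probe j s)
  probe∈R† j s k with k ≟ j
  ... | yes refl rewrite probe-at j s    = m^n>0 p (e j ∸ s) , ^-monoʳ-≤ p (m∸n≤m (e j) s)
  ... | no k≢j   rewrite probe-off j s k k≢j = m^n>0 p (e k) , ≤-refl

  probe∈A⇔ : (∀ k → e k ≤ e last) → ∀ β j s → s ≤ e j →
             InA r p β (probe j s) ⇔ p ^ s ∣ β j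
  probe∈A⇔ e≤E β j s s≤eⱼ =
    mk⇔ (λ (_ , pᴱ∣Σ) → to pᴱ∣termⱼ⇔ (to pᴱ∣Σ⇔ pᴱ∣Σ))
        (λ pˢ∣βⱼ → probe∈R† j s , from pᴱ∣Σ⇔ (from pᴱ∣termⱼ⇔ pˢ∣βⱼ))
    where
    E : ℕ
    E = e last
    term : Fin (suc n) → ℕ
    term k = p ^ (E ∸ e k) * probe j s k * β k

    pᴱ∣term : ∀ k → k ≢ j → p ^ E ∣ term k
    pᴱ∣term k k≢j rewrite probe-off j s k k≢j | m^[n∸k]*m^k≡m^n p (e≤E k) = m∣m*n (β k)

    pᴱ∣Σ⇔ : p ^ E ∣ sumFin term ⇔ p ^ E ∣ term j
    pᴱ∣Σ⇔ = ∣sumFin⇔∣ term j pᴱ∣term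

    pᴱ∣termⱼ⇔ : p ^ E ∣ term j ⇔ p ^ s ∣ β j
    pᴱ∣termⱼ⇔ rewrite probe-at j s | *-assoc (p ^ (E ∸ e j)) (p ^ (e j ∸ s)) (β j) =
      ⇔-trans (m^n∣m^[n∸k]*x⇔m^k∣x p _ (e≤E j)) (m^n∣m^[n∸k]*x⇔m^k∣x p (β j) s≤eⱼ)

  ⊆⇒^∣-transfer : (∀ k → e k ≤ e last) → ∀ β β′ → (∀ ω → InA r p β ω → InA r p β′ ω) →
                  ∀ j .{{_ : NonZero (r j)}} s → p ^ s ∣ r j → p ^ s ∣ β j → p ^ s ∣ β′ j
  ⊆⇒^∣-transfer e≤E β β′ A⊆A′ j s pˢ∣rⱼ pˢ∣βⱼ =
    to (probe∈A⇔ e≤E β′ j s s≤eⱼ) (A⊆A′ (probe j s) (from (probe∈A⇔ e≤E β j s s≤eⱼ) pˢ∣βⱼ))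
    where
    s≤eⱼ : s ≤ e j
    s≤eⱼ = to (^∣⇔≤vp (r j) s) pˢ∣rⱼ

lemma4p7 : (n : ℕ) (r : Fin (suc n) → ℕ) →
    (∀ j → 1 ≤ r j) →
    (∀ (j : Fin n) → r (inject₁ j) ∣ r (fsuc j)) →
    (p : ℕ) → Prime p → p ∣ r last →
    (β β′ : Fin (suc n) → ℕ) →
    (∀ j → β j < r j) → (∀ j → β′ j < r j) →
    (∀ ω → (InA r p β ω → InA r p β′ ω) × (InA r p β′ ω → InA r p β ω)) →
    ∀ j → vp p (gcd (β j) (r j)) ≡ vp p (gcd (β′ j) (r j))
lemma4p7 n r r≥1 r∣r p p-prime _ β β′ _ _ A≡A′ j =
  ≤-antisym (vp-gcd-mono (β j) (β′ j) (r j) (transfer β β′ (proj₁ ∘ A≡A′) j))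
            (vp-gcd-mono (β′ j) (β j) (r j) (transfer β′ β (proj₂ ∘ A≡A′) j))
  where
  instance
    _ = prime⇒nonTrivial p-prime
    r≢0 : ∀ {k} → NonZero (r k)
    r≢0 {k} = >-nonZero (r≥1 k)
  open Probe r p
  transfer : ∀ β β′ → (∀ ω → InA r p β ω → InA r p β′ ω) →
             ∀ j .{{_ : NonZero (r j)}} s → p ^ s ∣ r j → p ^ s ∣ β j → p ^ s ∣ β′ j
  transfer = ⊆⇒^∣-transfer (λ k → vp-mono-∣ (∣-last n r r∣r k))
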